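{- Let $S$ be a Kleene relation algebra satisfying the Tarski rule and let $x \in S$ be univalent. Then $x^* \cdot (x^T)^* = (x \sqcup x^T)^*$.
   Context: A Kleene relation algebra is a structure $(S,\sqcup,\sqcap,\cdot,\overline{\phantom{x}},{}^T,{}^*,\bot,\top,1)$ such that $(S,\sqcup,\sqcap,\overline{\phantom{x}},\bot,\top)$ is a Boolean algebra with order $x \sqsubseteq y \iff x \sqcup y = y$; $(S,\sqcup,\cdot,\bot,1)$ is an idempotent semiring ($\cdot$ associative with two-sided unit $1$, distributing over $\sqcup$, $\bot$ a two-sided zero of $\cdot$); transposition satisfies $(x\sqcup y)^T = x^T \sqcup y^T$, $(x^T)^T = x$, $(x\cdot y)^T = y^T\cdot x^T$ and $(x\cdot y)\sqcap z \sqsubseteq x\cdot(y\sqcap(x^T\cdot z))$; and the star satisfies $1\sqcup y\cdot y^* = y^* = 1 \sqcup y^*\cdot y$, $z\sqcup y\cdot x\sqsubseteq x \Rightarrow y^*\cdot z\sqsubseteq x$, $z \sqcup x\cdot y \sqsubseteq x \Rightarrow z\cdot y^*\sqsubseteq x$. The Tarski rule states $\top\cdot x\cdot\top = \top$ for every $x \neq \bot$. An element $x$ is univalent if $x^T\cdot x \sqsubseteq 1$. -}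

module Defs where

open import Level using (Level; suc)
open import Relation.Binary.PropositionalEquality using (_≡_)
open import Relation.Nullary using (¬_)

record KleeneRelationAlgebra (ℓ : Level) : Set (suc ℓ) where
  infixl 6 _⊔_
  infixl 7 _⊓_
  infixl 8 _·_
  infix 4 _⊑_
  field
    S    : Set ℓ
    _⊔_  : S → S → S
    _⊓_  : S → S → S
    _·_  : S → S → S
    ∁    : S → S
    _ᵀ   : S → S
    _⋆   : S → S
    ⊥ ⊤ 𝟏 : S

  _⊑_ : S → S → Set ℓ
  x ⊑ y = x ⊔ y ≡ y

  field
    ⊔-assoc : ∀ x y z → (x ⊔ y) ⊔ z ≡ x ⊔ (y ⊔ z)
    ⊔-comm  : ∀ x y → x ⊔ y ≡ y ⊔ x
    ⊓-assoc : ∀ x y z → (x ⊓ y) ⊓ z ≡ x ⊓ (y ⊓ z)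
    ⊓-comm  : ∀ x y → x ⊓ y ≡ y ⊓ x
    ⊔-absorbs-⊓ : ∀ x y → x ⊔ (x ⊓ y) ≡ x
    ⊓-absorbs-⊔ : ∀ x y → x ⊓ (x ⊔ y) ≡ x
    ⊓-distrib-⊔ : ∀ x y z → x ⊓ (y ⊔ z) ≡ (x ⊓ y) ⊔ (x ⊓ z)
    ⊔-distrib-⊓ : ∀ x y z → x ⊔ (y ⊓ z) ≡ (x ⊔ y) ⊓ (x ⊔ z)
    ⊔-identity  : ∀ x → x ⊔ ⊥ ≡ x
    ⊓-identity  : ∀ x → x ⊓ ⊤ ≡ x
    ∁-⊔ : ∀ x → x ⊔ ∁ x ≡ ⊤
    ∁-⊓ : ∀ x → x ⊓ ∁ x ≡ ⊥

    ⊔-idem  : ∀ x → x ⊔ x ≡ x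
    ·-assoc : ∀ x y z → (x · y) · z ≡ x · (y · z)
    ·-identityˡ : ∀ x → 𝟏 · x ≡ x
    ·-identityʳ : ∀ x → x · 𝟏 ≡ x
    ·-distribˡ-⊔ : ∀ x y z → x · (y ⊔ z) ≡ (x · y) ⊔ (x · z)
    ·-distribʳ-⊔ : ∀ x y z → (y ⊔ z) · x ≡ (y · x) ⊔ (z · x)
    ·-zeroˡ : ∀ x → ⊥ · x ≡ ⊥
    ·-zeroʳ : ∀ x → x · ⊥ ≡ ⊥

    ᵀ-⊔ : ∀ x y → (x ⊔ y) ᵀ ≡ (x ᵀ) ⊔ (y ᵀ)
    ᵀ-involutive : ∀ x → (x ᵀ) ᵀ ≡ x
    ᵀ-· : ∀ x y → (x · y) ᵀ ≡ (y ᵀ) · (x ᵀ)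
    dedekind : ∀ x y z → (x · y) ⊓ z ⊑ x · (y ⊓ ((x ᵀ) · z))

    star-unfoldˡ : ∀ y → 𝟏 ⊔ y · (y ⋆) ≡ y ⋆
    star-unfoldʳ : ∀ y → 𝟏 ⊔ (y ⋆) · y ≡ y ⋆
    star-inductˡ : ∀ x y z → z ⊔ y · x ⊑ x → (y ⋆) · z ⊑ x
    star-inductʳ : ∀ x y z → z ⊔ x · y ⊑ x → z · (y ⋆) ⊑ x

  TarskiRule : Set ℓ
  TarskiRule = ∀ x → ¬ (x ≡ ⊥) → ⊤ · x · ⊤ ≡ ⊤

  univalent : S → Set ℓ
  univalent x = (x ᵀ) · x ⊑ 𝟏

-- Univalence of x makes xᵀ slide past x⋆: from xᵀ · x ⊑ 𝟏 one gets
-- xᵀ · x⋆ ⊑ xᵀ ⊔ x⋆, so x⋆ · xᵀ⋆ is closed under left multiplication by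
-- both x and xᵀ.  Star induction then puts (x ⊔ xᵀ)⋆ below x⋆ · xᵀ⋆, and the
-- converse inclusion holds in every Kleene algebra.
module Submission where

open import Defs
open import Level using (Level)
open import Relation.Binary.PropositionalEquality
  using (_≡_; refl; sym; trans; cong; cong₂; isEquivalence; module ≡-Reasoning)
open import Relation.Binary.Bundles using (Poset)
import Relation.Binary.Reasoning.PartialOrder as PosetReasoning

module KleeneRelationAlgebraProperties {ℓ : Level} (K : KleeneRelationAlgebra ℓ) where
  open KleeneRelationAlgebra K

  ⊑-refl : ∀ {a} → a ⊑ a
  ⊑-refl {a} = ⊔-idem a

  ⊑-reflexive : ∀ {a b} → a ≡ b → a ⊑ b
  ⊑-reflexive refl = ⊑-refl

  ⊑-trans : ∀ {a b c} → a ⊑ b → b ⊑ c → a ⊑ c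
  ⊑-trans {a} {b} {c} a⊑b b⊑c = begin
    a ⊔ c        ≡⟨ cong (a ⊔_) b⊑c ⟨
    a ⊔ (b ⊔ c)  ≡⟨ ⊔-assoc a b c ⟨
    (a ⊔ b) ⊔ c  ≡⟨ cong (_⊔ c) a⊑b ⟩
    b ⊔ c        ≡⟨ b⊑c ⟩
    c            ∎
    where open ≡-Reasoning

  ⊑-antisym : ∀ {a b} → a ⊑ b → b ⊑ a → a ≡ b
  ⊑-antisym {a} {b} a⊑b b⊑a = trans (sym b⊑a) (trans (⊔-comm b a) a⊑b)

  ⊑-poset : Poset ℓ ℓ ℓ
  ⊑-poset = record
    { Carrier = S
    ; _≈_ = _≡_
    ; _≤_ = _⊑_
    ; isPartialOrder = record
      { isPreorder = record
        { isEquivalence = isEquivalence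
        ; reflexive = ⊑-reflexive
        ; trans = ⊑-trans
        }
      ; antisym = ⊑-antisym
      }
    }

  open PosetReasoning ⊑-poset

  x⊑x⊔y : ∀ a b → a ⊑ a ⊔ b
  x⊑x⊔y a b = trans (sym (⊔-assoc a a b)) (cong (_⊔ b) (⊔-idem a))

  y⊑x⊔y : ∀ a b → b ⊑ a ⊔ b
  y⊑x⊔y a b = trans (cong (b ⊔_) (⊔-comm a b)) (trans (x⊑x⊔y b a) (⊔-comm b a))

  ⊔-lub : ∀ {a b c} → a ⊑ c → b ⊑ c → a ⊔ b ⊑ c
  ⊔-lub {a} {b} {c} a⊑c b⊑c = trans (⊔-assoc a b c) (trans (cong (a ⊔_) b⊑c) a⊑c)

  ⊔-mono-⊑ : ∀ {a b c d} → a ⊑ c → b ⊑ d → a ⊔ b ⊑ c ⊔ d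
  ⊔-mono-⊑ {c = c} {d} a⊑c b⊑d =
    ⊔-lub (⊑-trans a⊑c (x⊑x⊔y c d)) (⊑-trans b⊑d (y⊑x⊔y c d))

  ·-monoʳ-⊑ : ∀ c {a b} → a ⊑ b → c · a ⊑ c · b
  ·-monoʳ-⊑ c {a} {b} a⊑b = trans (sym (·-distribˡ-⊔ c a b)) (cong (c ·_) a⊑b)

  ·-monoˡ-⊑ : ∀ c {a b} → a ⊑ b → a · c ⊑ b · c
  ·-monoˡ-⊑ c {a} {b} a⊑b = trans (sym (·-distribʳ-⊔ c a b)) (cong (_· c) a⊑b)

  ·-mono-⊑ : ∀ {a b c d} → a ⊑ c → b ⊑ d → a · b ⊑ c · d
  ·-mono-⊑ {b = b} {c} a⊑c b⊑d = ⊑-trans (·-monoˡ-⊑ b a⊑c) (·-monoʳ-⊑ c b⊑d)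

  𝟏⊑star : ∀ a → 𝟏 ⊑ a ⋆
  𝟏⊑star a = ⊑-trans (x⊑x⊔y 𝟏 (a · a ⋆)) (⊑-reflexive (star-unfoldˡ a))

  x·star⊑star : ∀ a → a · a ⋆ ⊑ a ⋆
  x·star⊑star a = ⊑-trans (y⊑x⊔y 𝟏 (a · a ⋆)) (⊑-reflexive (star-unfoldˡ a))

  star-inductˡ-𝟏 : ∀ {a b} → 𝟏 ⊑ b → a · b ⊑ b → a ⋆ ⊑ b
  star-inductˡ-𝟏 {a} {b} 𝟏⊑b ab⊑b = begin
    a ⋆      ≡⟨ ·-identityʳ (a ⋆) ⟨
    a ⋆ · 𝟏  ≤⟨ star-inductˡ b a 𝟏 (⊔-lub 𝟏⊑b ab⊑b) ⟩
    b        ∎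

  star·star⊑star : ∀ a → a ⋆ · a ⋆ ⊑ a ⋆
  star·star⊑star a = star-inductˡ (a ⋆) a (a ⋆) (⊔-lub ⊑-refl (x·star⊑star a))

  star-mono-⊑ : ∀ {a b} → a ⊑ b → a ⋆ ⊑ b ⋆
  star-mono-⊑ {a} {b} a⊑b =
    star-inductˡ-𝟏 (𝟏⊑star b) (⊑-trans (·-monoˡ-⊑ (b ⋆) a⊑b) (x·star⊑star b))

  star·star⊑star-⊔ : ∀ a b → a ⋆ · b ⋆ ⊑ (a ⊔ b) ⋆
  star·star⊑star-⊔ a b = begin
    a ⋆ · b ⋆              ≤⟨ ·-mono-⊑ (star-mono-⊑ (x⊑x⊔y a b)) (star-mono-⊑ (y⊑x⊔y a b)) ⟩
    (a ⊔ b) ⋆ · (a ⊔ b) ⋆  ≤⟨ star·star⊑star (a ⊔ b) ⟩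
    (a ⊔ b) ⋆              ∎

  ·-star-swap : ∀ {a b} → b · a ⊑ 𝟏 → b · a ⋆ ⊑ b ⊔ a ⋆
  ·-star-swap {a} {b} ba⊑𝟏 = begin
    b · a ⋆                  ≡⟨ cong (b ·_) (star-unfoldˡ a) ⟨
    b · (𝟏 ⊔ a · a ⋆)        ≡⟨ ·-distribˡ-⊔ b 𝟏 (a · a ⋆) ⟩
    b · 𝟏 ⊔ b · (a · a ⋆)    ≡⟨ cong₂ _⊔_ (·-identityʳ b) (sym (·-assoc b a (a ⋆))) ⟩
    b ⊔ (b · a) · a ⋆        ≤⟨ ⊔-mono-⊑ ⊑-refl (·-monoˡ-⊑ (a ⋆) ba⊑𝟏) ⟩
    b ⊔ 𝟏 · a ⋆              ≡⟨ cong (b ⊔_) (·-identityˡ (a ⋆)) ⟩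
    b ⊔ a ⋆                  ∎

  star-⊔⊑star·star : ∀ a b → b · a ⋆ ⊑ b ⊔ a ⋆ → (a ⊔ b) ⋆ ⊑ a ⋆ · b ⋆
  star-⊔⊑star·star a b swap = star-inductˡ-𝟏 𝟏⊑P (begin
    (a ⊔ b) · P    ≡⟨ ·-distribʳ-⊔ P a b ⟩
    a · P ⊔ b · P  ≤⟨ ⊔-lub aP⊑P bP⊑P ⟩
    P              ∎)
    where
    P : S
    P = a ⋆ · b ⋆

    a⋆⊑P : a ⋆ ⊑ P
    a⋆⊑P = ⊑-trans (⊑-reflexive (sym (·-identityʳ (a ⋆)))) (·-monoʳ-⊑ (a ⋆) (𝟏⊑star b))

    b⋆⊑P : b ⋆ ⊑ P
    b⋆⊑P = ⊑-trans (⊑-reflexive (sym (·-identityˡ (b ⋆)))) (·-monoˡ-⊑ (b ⋆) (𝟏⊑star a))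

    𝟏⊑P : 𝟏 ⊑ P
    𝟏⊑P = ⊑-trans (𝟏⊑star a) a⋆⊑P

    aP⊑P : a · P ⊑ P
    aP⊑P = ⊑-trans (⊑-reflexive (sym (·-assoc a (a ⋆) (b ⋆)))) (·-monoˡ-⊑ (b ⋆) (x·star⊑star a))

    bP⊑P : b · P ⊑ P
    bP⊑P = begin
      b · (a ⋆ · b ⋆)      ≡⟨ ·-assoc b (a ⋆) (b ⋆) ⟨
      (b · a ⋆) · b ⋆      ≤⟨ ·-monoˡ-⊑ (b ⋆) swap ⟩
      (b ⊔ a ⋆) · b ⋆      ≡⟨ ·-distribʳ-⊔ (b ⋆) b (a ⋆) ⟩
      b · b ⋆ ⊔ P          ≤⟨ ⊔-lub (⊑-trans (x·star⊑star b) b⋆⊑P) ⊑-refl ⟩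
      P                    ∎

  univalent⇒star·starᵀ≡star-⊔ : ∀ x → univalent x → x ⋆ · (x ᵀ) ⋆ ≡ (x ⊔ x ᵀ) ⋆
  univalent⇒star·starᵀ≡star-⊔ x xᵀx⊑𝟏 = ⊑-antisym
    (star·star⊑star-⊔ x (x ᵀ))
    (star-⊔⊑star·star x (x ᵀ) (·-star-swap xᵀx⊑𝟏))

theorem4p8 : ∀ {ℓ : Level} (K : KleeneRelationAlgebra ℓ) →
    let open KleeneRelationAlgebra K in
    TarskiRule → ∀ (x : S) → univalent x →
    (x ⋆) · ((x ᵀ) ⋆) ≡ (x ⊔ (x ᵀ)) ⋆
theorem4p8 K _ = univalent⇒star·starᵀ≡star-⊔
  where open KleeneRelationAlgebraProperties K
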